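{- Let $\mathbf{P}$ be a finite poset in $C(2)$, i.e. $\mathbf{P}$ has an interval representation in which every interval has length between $1$ and $2$ inclusive. Then $\dim(\mathbf{P})\le 4$.
   Context: An interval representation of a poset $(X,P)$ assigns to each $x\in X$ a closed real interval $[l_x,r_x]$ such that $x<y$ in $P$ iff $r_x<l_y$. $C(\alpha)=C[1,\alpha]$ denotes the class of posets having an interval representation with all interval lengths in $[1,\alpha]$. The dimension $\dim(\mathbf{P})$ is the minimum number of linear extensions of $P$ whose intersection is $P$.
   Formalization: The intervals $[l_x,r_x]$ of the representation witnessing membership in $C(2)$ have rational endpoints instead of real ones. -}

module Defs where

open import Level using (0ℓ)
open import Data.Nat using (ℕ; _≤_)
open import Data.Fin using (Fin)
open import Data.Product using (Σ; _×_; ∃)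
open import Function.Bundles using (_⇔_)
open import Relation.Binary.Core using (Rel)
open import Relation.Binary.Structures using (IsStrictPartialOrder; IsStrictTotalOrder)
open import Relation.Binary.PropositionalEquality using (_≡_)
import Data.Rational as ℚ
open ℚ using (ℚ; 1ℚ)

record FinPoset (n : ℕ) : Set₁ where
  field
    _<P_ : Rel (Fin n) 0ℓ
    isSPO : IsStrictPartialOrder _≡_ _<P_
open FinPoset public

2ℚ : ℚ
2ℚ = 1ℚ ℚ.+ 1ℚ

record IntervalRep {n : ℕ} (P : FinPoset n) (α : ℚ) : Set where
  field
    l r : Fin n → ℚ
    lenLower : ∀ x → 1ℚ ℚ.≤ (r x ℚ.- l x)
    lenUpper : ∀ x → (r x ℚ.- l x) ℚ.≤ α
    rep : ∀ x y → (_<P_ P x y ⇔ (r x ℚ.< l y))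

InC : ∀ {n} → ℚ → FinPoset n → Set
InC α P = IntervalRep P α

record LinearExtension {n : ℕ} (P : FinPoset n) : Set₁ where
  field
    _<L_ : Rel (Fin n) 0ℓ
    isSTO : IsStrictTotalOrder _≡_ _<L_
    extends : ∀ x y → _<P_ P x y → x <L y
open LinearExtension public

record Realizer {n : ℕ} (P : FinPoset n) (t : ℕ) : Set₁ where
  field
    ext : Fin t → LinearExtension P
    intersection : ∀ x y → (_<P_ P x y ⇔ (∀ i → _<L_ (ext i) x y))

DimLe : ∀ {n} → FinPoset n → ℕ → Set₁
DimLe P k = Σ ℕ (λ t → (t ≤ k) × Realizer P t)

-- Let c x = ⌊l x⌋. As every interval has length in [1,2], x < y in P forces c x < c y,
-- while overlapping intervals (l y ≤ r x) satisfy c y ≤ c x + 2. The first linear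
-- extension sorts by c and, within a cell, by decreasing l, then decreasing r. For each
-- shift s ∈ {0,1,2}, writing c + s = 3b + ρ groups the cells into blocks b of three
-- consecutive cells; the extension for s sorts by b and, inside a block, by r on the
-- cell at position ρ = 0 and by l on the two others, equal endpoints going to the larger
-- ρ. An overlapping pair in different cells lies in one block for the shift putting the
-- lower cell at position 0, where it is reversed; a pair in the same cell is reversed by
-- the first extension or by a block extension sorting that cell by l or by r. Identical
-- intervals are told apart by their index, compared in opposite directions by the first
-- and the block extensions.
module Submission where

open import Data.Fin as Fin using (Fin; toℕ; zero; suc)
import Data.Fin.Properties as Fin
open import Data.Integer as ℤ using (ℤ; +_; _/ℕ_; _%ℕ_)
import Data.Integer.Properties as ℤ
open import Data.Integer.DivMod
  using (a≡a%ℕn+[a/ℕn]*n; n%ℕd<d; div-pos-is-/ℕ; [n/d]*d≤n; n<s[n/ℕd]*d)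
open import Data.Integer.Tactic.RingSolver using (solve-∀)
open import Data.Nat as ℕ using (ℕ; zero; suc)
import Data.Nat.Properties as ℕ
open import Data.Product using (Σ-syntax; ∃-syntax; _×_; _,_; proj₂)
open import Data.Product.Relation.Binary.Lex.Strict using (×-Lex; ×-isStrictTotalOrder)
open import Data.Product.Relation.Binary.Pointwise.NonDependent using (Pointwise; ≡×≡⇒≡)
open import Data.Rational as ℚ using (ℚ; mkℚ; 1ℚ; floor; toℚᵘ)
import Data.Rational.Properties as ℚ
open import Data.Rational.Unnormalised as ℚᵘ using (ℚᵘ; *≤*; *<*; *≡*)
import Data.Rational.Unnormalised.Properties as ℚᵘ
open import Data.Sum using (_⊎_; inj₁; inj₂)
open import Defs
open import Function using (_∘_; _on_; flip)
open import Function.Bundles using (Equivalence; mk⇔)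
open import Level using (0ℓ)
open import Relation.Binary.Core using (Rel)
import Relation.Binary.Construct.Flip.EqAndOrd as Flip
open import Relation.Binary.Definitions using (Trichotomous; tri<; tri≈; tri>)
open import Relation.Binary.PropositionalEquality
open import Relation.Binary.Structures using (IsStrictPartialOrder; IsStrictTotalOrder)
open import Relation.Nullary using (¬_; contradiction; yes; no)

open import Algebra.Properties.CommutativeSemigroup ℤ.+-commutativeSemigroup using (x∙yz≈y∙xz)
open import Algebra.Properties.Group ℚ.+-0-group using (//-rightDividesˡ)

fromℤ : ℤ → ℚᵘ
fromℤ k = k ℚᵘ./ 1

fromℤ-homo-+ : ∀ i j → fromℤ (i ℤ.+ j) ℚᵘ.≃ fromℤ i ℚᵘ.+ fromℤ j
fromℤ-homo-+ i j = *≡* (identity i j)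
  where
  identity : ∀ i j → (i ℤ.+ j) ℤ.* + 1 ≡ (i ℤ.* + 1 ℤ.+ j ℤ.* + 1) ℤ.* + 1
  identity = solve-∀

fromℤ-<-suc⇒≤ : ∀ {i j} → fromℤ i ℚᵘ.< fromℤ (ℤ.suc j) → i ℤ.≤ j
fromℤ-<-suc⇒≤ {i} {j} (*<* i<1+j) =
  subst (i ℤ.≤_) (ℤ.pred-suc j)
    (ℤ.i<j⇒i≤pred[j] (subst₂ ℤ._<_ (ℤ.*-identityʳ i) (ℤ.*-identityʳ (ℤ.suc j)) i<1+j))

floor-≤ : ∀ p → fromℤ (floor p) ℚᵘ.≤ toℚᵘ p
floor-≤ (mkℚ n d _) =
  *≤* (subst (n ℤ./ + suc d ℤ.* + suc d ℤ.≤_) (sym (ℤ.*-identityʳ n)) ([n/d]*d≤n n (+ suc d)))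

<-suc-floor : ∀ p → toℚᵘ p ℚᵘ.< fromℤ (ℤ.suc (floor p))
<-suc-floor (mkℚ n d _) = *<* (subst₂ ℤ._<_ (sym (ℤ.*-identityʳ n))
  (cong (λ q → ℤ.suc q ℤ.* + suc d) (sym (div-pos-is-/ℕ n (suc d)))) (n<s[n/ℕd]*d n (suc d)))

toℚᵘ-+-fromℤ : ∀ k p → toℚᵘ (k ℚ./ 1 ℚ.+ p) ℚᵘ.≃ fromℤ k ℚᵘ.+ toℚᵘ p
toℚᵘ-+-fromℤ k p = ℚᵘ.≃-trans (ℚ.toℚᵘ-homo-+ (k ℚ./ 1) p)
                               (ℚᵘ.+-congˡ (toℚᵘ p) (ℚ.toℚᵘ-fromℚᵘ (fromℤ k)))

k+p≤q⇒k+⌊p⌋≤⌊q⌋ : ∀ k {p q} → k ℚ./ 1 ℚ.+ p ℚ.≤ q → k ℤ.+ floor p ℤ.≤ floor q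
k+p≤q⇒k+⌊p⌋≤⌊q⌋ k {p} {q} k+p≤q = fromℤ-<-suc⇒≤ (begin-strict
  fromℤ (k ℤ.+ floor p)          ≃⟨ fromℤ-homo-+ k (floor p) ⟩
  fromℤ k ℚᵘ.+ fromℤ (floor p)   ≤⟨ ℚᵘ.+-monoʳ-≤ (fromℤ k) (floor-≤ p) ⟩
  fromℤ k ℚᵘ.+ toℚᵘ p            ≃⟨ toℚᵘ-+-fromℤ k p ⟨
  toℚᵘ (k ℚ./ 1 ℚ.+ p)           ≤⟨ ℚ.toℚᵘ-mono-≤ k+p≤q ⟩
  toℚᵘ q                         <⟨ <-suc-floor q ⟩
  fromℤ (ℤ.suc (floor q))        ∎)
  where open ℚᵘ.≤-Reasoning

q≤k+p⇒⌊q⌋≤k+⌊p⌋ : ∀ k {p q} → q ℚ.≤ k ℚ./ 1 ℚ.+ p → floor q ℤ.≤ k ℤ.+ floor p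
q≤k+p⇒⌊q⌋≤k+⌊p⌋ k {p} {q} q≤k+p = fromℤ-<-suc⇒≤ (begin-strict
  fromℤ (floor q)                      ≤⟨ floor-≤ q ⟩
  toℚᵘ q                               ≤⟨ ℚ.toℚᵘ-mono-≤ q≤k+p ⟩
  toℚᵘ (k ℚ./ 1 ℚ.+ p)                 ≃⟨ toℚᵘ-+-fromℤ k p ⟩
  fromℤ k ℚᵘ.+ toℚᵘ p                  <⟨ ℚᵘ.+-monoʳ-< (fromℤ k) (<-suc-floor p) ⟩
  fromℤ k ℚᵘ.+ fromℤ (ℤ.suc (floor p)) ≃⟨ fromℤ-homo-+ k (ℤ.suc (floor p)) ⟨
  fromℤ (k ℤ.+ ℤ.suc (floor p))        ≡⟨ cong fromℤ (x∙yz≈y∙xz k (+ 1) (floor p)) ⟩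
  fromℤ (ℤ.suc (k ℤ.+ floor p))        ∎)
  where open ℚᵘ.≤-Reasoning

i≤a+j⇒i+k≤a+[j+k] : ∀ {i j} a k → i ℤ.≤ a ℤ.+ j → i ℤ.+ k ℤ.≤ a ℤ.+ (j ℤ.+ k)
i≤a+j⇒i+k≤a+[j+k] {i} {j} a k i≤a+j =
  subst (i ℤ.+ k ℤ.≤_) (ℤ.+-assoc a j k) (ℤ.+-monoˡ-≤ k i≤a+j)

r+q*d<r′+q′*d : ∀ d {r r′ q q′} → r ℕ.< d → q ℤ.< q′ →
                + r ℤ.+ q ℤ.* + d ℤ.< + r′ ℤ.+ q′ ℤ.* + d
r+q*d<r′+q′*d d {r} {r′} {q} {q′} r<d q<q′ = begin-strict
  + r ℤ.+ q ℤ.* + d   <⟨ ℤ.+-monoˡ-< (q ℤ.* + d) (ℤ.+<+ r<d) ⟩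
  + d ℤ.+ q ℤ.* + d   ≡⟨ ℤ.suc-* q (+ d) ⟨
  ℤ.suc q ℤ.* + d     ≤⟨ ℤ.*-monoʳ-≤-nonNeg (+ d) (ℤ.i<j⇒suc[i]≤j q<q′) ⟩
  q′ ℤ.* + d          ≤⟨ ℤ.i≤j+i (q′ ℤ.* + d) (+ r′) ⟩
  + r′ ℤ.+ q′ ℤ.* + d ∎
  where open ℤ.≤-Reasoning

module _ (d : ℕ) .{{_ : ℕ.NonZero d}} where

  _<ₗₑₓ_ : Rel (ℤ × ℕ) 0ℓ
  _<ₗₑₓ_ = ×-Lex _≡_ ℤ._<_ ℕ._<_

  quotRem : ℤ → ℤ × ℕ
  quotRem m = m /ℕ d , m %ℕ d

  fromQuotRem : ℤ × ℕ → ℤ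
  fromQuotRem (q , r) = + r ℤ.+ q ℤ.* + d

  private
    division : ∀ m → m ≡ fromQuotRem (quotRem m)
    division m = a≡a%ℕn+[a/ℕn]*n m d

    <ₗₑₓ-isStrictTotalOrder : IsStrictTotalOrder (Pointwise _≡_ _≡_) _<ₗₑₓ_
    <ₗₑₓ-isStrictTotalOrder = ×-isStrictTotalOrder ℤ.<-isStrictTotalOrder ℕ.<-isStrictTotalOrder

  fromQuotRem-mono : ∀ {q q′ r r′} → r ℕ.< d → (q , r) <ₗₑₓ (q′ , r′) →
                     fromQuotRem (q , r) ℤ.< fromQuotRem (q′ , r′)
  fromQuotRem-mono r<d (inj₁ q<q′)              = r+q*d<r′+q′*d d r<d q<q′
  fromQuotRem-mono {q} _ (inj₂ (refl , r<r′)) = ℤ.+-monoˡ-< (q ℤ.* + d) (ℤ.+<+ r<r′)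

  <⇒quotRem-<ₗₑₓ : ∀ {m m′} → m ℤ.< m′ → quotRem m <ₗₑₓ quotRem m′
  <⇒quotRem-<ₗₑₓ {m} {m′} m<m′
    with IsStrictTotalOrder.compare <ₗₑₓ-isStrictTotalOrder (quotRem m) (quotRem m′)
  ... | tri< lt _ _ = lt
  ... | tri≈ _ eq _ = contradiction
    (trans (division m) (trans (cong fromQuotRem (≡×≡⇒≡ eq)) (sym (division m′))))
    (ℤ.<⇒≢ m<m′)
  ... | tri> _ _ gt = contradiction
    (subst₂ ℤ._<_ (sym (division m′)) (sym (division m)) (fromQuotRem-mono (n%ℕd<d m′ d) gt))
    (ℤ.<-asym m<m′)

  [r+q*d]%ℕd≡r : ∀ {q r} → r ℕ.< d → (+ r ℤ.+ q ℤ.* + d) %ℕ d ≡ r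
  [r+q*d]%ℕd≡r {q} {r} r<d
    with IsStrictTotalOrder.compare <ₗₑₓ-isStrictTotalOrder (q , r) (quotRem (+ r ℤ.+ q ℤ.* + d))
  ... | tri< lt _ _ = contradiction (fromQuotRem-mono r<d lt) (ℤ.<-irrefl (division _))
  ... | tri≈ _ (_ , r≡) _ = sym r≡
  ... | tri> _ _ gt = contradiction (fromQuotRem-mono (n%ℕd<d (+ r ℤ.+ q ℤ.* + d) d) gt)
                                    (ℤ.<-irrefl (sym (division _)))

  remainder-shift : ∀ m {t} → t ℕ.< d → Σ[ s ∈ Fin d ] (m ℤ.+ + toℕ s) %ℕ d ≡ t
  remainder-shift m {t} t<d = Fin.fromℕ< (n%ℕd<d u d) , (begin
    (m ℤ.+ + toℕ (Fin.fromℕ< (n%ℕd<d u d))) %ℕ d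
      ≡⟨ cong (λ s → (m ℤ.+ + s) %ℕ d) (Fin.toℕ-fromℕ< (n%ℕd<d u d)) ⟩
    (m ℤ.+ + (u %ℕ d)) %ℕ d
      ≡⟨ cong (_%ℕ d) (m+r≡t-q*D m (+ t) (+ (u %ℕ d)) (u /ℕ d) (+ d) (division u)) ⟩
    (+ t ℤ.+ ℤ.- (u /ℕ d) ℤ.* + d) %ℕ d
      ≡⟨ [r+q*d]%ℕd≡r {q = ℤ.- (u /ℕ d)} t<d ⟩
    t ∎)
    where
    open ≡-Reasoning
    u = + t ℤ.- m
    m+r≡t-q*D : ∀ m t r q D → t ℤ.- m ≡ r ℤ.+ q ℤ.* D → m ℤ.+ r ≡ t ℤ.+ ℤ.- q ℤ.* D
    m+r≡t-q*D m t r q D t-m≡r+qD = begin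
      m ℤ.+ r                              ≡⟨ add-sub m r q D ⟩
      m ℤ.+ (r ℤ.+ q ℤ.* D) ℤ.- q ℤ.* D    ≡⟨ cong (λ v → m ℤ.+ v ℤ.- q ℤ.* D) t-m≡r+qD ⟨
      m ℤ.+ (t ℤ.- m) ℤ.- q ℤ.* D          ≡⟨ cancel-m m t q D ⟩
      t ℤ.+ ℤ.- q ℤ.* D                    ∎
      where
      add-sub : ∀ m r q D → m ℤ.+ r ≡ m ℤ.+ (r ℤ.+ q ℤ.* D) ℤ.- q ℤ.* D
      add-sub = solve-∀
      cancel-m : ∀ m t q D → m ℤ.+ (t ℤ.- m) ℤ.- q ℤ.* D ≡ t ℤ.+ ℤ.- q ℤ.* D
      cancel-m = solve-∀

sameBlock : ∀ e {m m′} → m %ℕ suc e ≡ 0 → m ℤ.< m′ → m′ ℤ.≤ + e ℤ.+ m →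
            m′ /ℕ suc e ≡ m /ℕ suc e × 0 ℕ.< m′ %ℕ suc e
sameBlock e {m} {m′} m%d≡0 m<m′ m′≤e+m with <⇒quotRem-<ₗₑₓ (suc e) m<m′
... | inj₂ (q≡q′ , r<r′) = sym q≡q′ , subst (ℕ._< m′ %ℕ suc e) m%d≡0 r<r′
... | inj₁ q<q′ = contradiction (begin-strict
  m′                                            ≤⟨ m′≤e+m ⟩
  + e ℤ.+ m                                     ≡⟨ cong (ℤ._+_ (+ e)) m≡q*d ⟩
  + e ℤ.+ (m /ℕ suc e) ℤ.* + suc e              <⟨ r+q*d<r′+q′*d (suc e) (ℕ.n<1+n e) q<q′ ⟩
  + (m′ %ℕ suc e) ℤ.+ (m′ /ℕ suc e) ℤ.* + suc e ≡⟨ a≡a%ℕn+[a/ℕn]*n m′ (suc e) ⟨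
  m′                                            ∎) (ℤ.<-irrefl refl)
  where
  open ℤ.≤-Reasoning
  m≡q*d : m ≡ (m /ℕ suc e) ℤ.* + suc e
  m≡q*d = trans (a≡a%ℕn+[a/ℕn]*n m (suc e))
                (trans (cong (λ r → + r ℤ.+ (m /ℕ suc e) ℤ.* + suc e) m%d≡0) (ℤ.+-identityˡ _))

module _ {A K : Set} {_≈_ _<_ : Rel K 0ℓ} (order : IsStrictTotalOrder _≈_ _<_)
         (key : A → K) (key-injective : ∀ {x y} → key x ≈ key y → x ≡ y) where
  private module O = IsStrictTotalOrder order

  on-injective-isStrictTotalOrder : IsStrictTotalOrder _≡_ (_<_ on key)
  on-injective-isStrictTotalOrder = record
    { isStrictPartialOrder = record
      { isEquivalence = isEquivalence
      ; irrefl        = λ { refl → O.irrefl O.Eq.refl }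
      ; trans         = O.trans
      ; <-resp-≈      = resp₂ (_<_ on key)
      }
    ; compare = compare
    }
    where
    key-cong : ∀ {x y} → x ≡ y → key x ≈ key y
    key-cong refl = O.Eq.refl

    compare : Trichotomous _≡_ (_<_ on key)
    compare x y with O.compare (key x) (key y)
    ... | tri< a ¬b ¬c = tri< a (¬b ∘ key-cong) ¬c
    ... | tri≈ ¬a b ¬c = tri≈ ¬a (key-injective b) ¬c
    ... | tri> ¬a ¬b c = tri> ¬a (¬b ∘ key-cong) c

module _ {n : ℕ} (P : FinPoset n) where

  keyedExtension : ∀ {K : Set} {_≈_ _<_ : Rel K 0ℓ} → IsStrictTotalOrder _≈_ _<_ →
                   (key : Fin n → K) → (∀ {x y} → key x ≈ key y → x ≡ y) →
                   (∀ x y → _<P_ P x y → key x < key y) → LinearExtension P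
  keyedExtension {_<_ = _<_} order key key-injective key-mono = record
    { _<L_    = _<_ on key
    ; isSTO   = on-injective-isStrictTotalOrder order key key-injective
    ; extends = key-mono
    }

  realizer-fromReversals : ∀ {t} (L : Fin t → LinearExtension P) →
                           (∀ x y → _<P_ P x y ⊎ ∃[ i ] ¬ _<L_ (L i) x y) → Realizer P t
  realizer-fromReversals L separated = record
    { ext          = L
    ; intersection = λ x y → mk⇔ (λ x<y i → extends (L i) x y x<y) (fromAll x y)
    }
    where
    fromAll : ∀ x y → (∀ i → _<L_ (L i) x y) → _<P_ P x y
    fromAll x y x<ᵢy with separated x y
    ... | inj₁ x<y        = x<y
    ... | inj₂ (i , x≮ᵢy) = contradiction (x<ᵢy i) x≮ᵢy

module _ {n : ℕ} (P : FinPoset n) (I : InC 2ℚ P) where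
  open IntervalRep I

  <P⇒r<l : ∀ {x y} → _<P_ P x y → r x ℚ.< l y
  <P⇒r<l {x} {y} = Equivalence.to (rep x y)

  r<l⇒<P : ∀ {x y} → r x ℚ.< l y → _<P_ P x y
  r<l⇒<P {x} {y} = Equivalence.from (rep x y)

  l≤r : ∀ x → l x ℚ.≤ r x
  l≤r x = ℚ.≮⇒≥ (IsStrictPartialOrder.irrefl (isSPO P) refl ∘ r<l⇒<P)

  1+l≤r : ∀ x → 1ℚ ℚ.+ l x ℚ.≤ r x
  1+l≤r x = subst (1ℚ ℚ.+ l x ℚ.≤_) (//-rightDividesˡ (l x) (r x)) (ℚ.+-monoˡ-≤ (l x) (lenLower x))

  r≤2+l : ∀ x → r x ℚ.≤ 2ℚ ℚ.+ l x
  r≤2+l x = subst (ℚ._≤ 2ℚ ℚ.+ l x) (//-rightDividesˡ (l x) (r x)) (ℚ.+-monoˡ-≤ (l x) (lenUpper x))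

  cell : Fin n → ℤ
  cell x = floor (l x)

  cell-< : ∀ {x y} → r x ℚ.< l y → cell x ℤ.< cell y
  cell-< {x} rx<ly = ℤ.suc[i]≤j⇒i<j (k+p≤q⇒k+⌊p⌋≤⌊q⌋ (+ 1) {l x} (ℚ.≤-trans (1+l≤r x) (ℚ.<⇒≤ rx<ly)))

  -- 2ℚ = 1ℚ ℚ.+ 1ℚ and + 2 ℚ./ 1 are definitionally equal.
  cell-≤ : ∀ {x y} → l y ℚ.≤ r x → cell y ℤ.≤ + 2 ℤ.+ cell x
  cell-≤ {x} ly≤rx = q≤k+p⇒⌊q⌋≤k+⌊p⌋ (+ 2) {l x} (ℚ.≤-trans ly≤rx (r≤2+l x))

  cellKey : Fin n → ℤ × ℚ × ℚ × Fin n
  cellKey x = cell x , l x , r x , x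

  cellExtension : LinearExtension P
  cellExtension = keyedExtension P
    (×-isStrictTotalOrder ℤ.<-isStrictTotalOrder
      (×-isStrictTotalOrder (Flip.isStrictTotalOrder ℚ.<-isStrictTotalOrder)
        (×-isStrictTotalOrder (Flip.isStrictTotalOrder ℚ.<-isStrictTotalOrder)
          (Flip.isStrictTotalOrder Fin.<-isStrictTotalOrder))))
    cellKey (proj₂ ∘ proj₂ ∘ proj₂) (λ _ _ x<y → inj₁ (cell-< (<P⇒r<l x<y)))

  endpoint : ℕ → Fin n → ℚ
  endpoint zero    = r
  endpoint (suc _) = l

  endpoint-< : ∀ {ρ ρ′ x y} → ρ ℕ.< ρ′ → r x ℚ.< l y → endpoint ρ x ℚ.< endpoint ρ′ y
  endpoint-< {zero}  {suc _}     _ rx<ly = rx<ly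
  endpoint-< {suc _} {suc _} {x} _ rx<ly = ℚ.≤-<-trans (l≤r x) rx<ly

  _<ᵉ_ : Rel (ℚ × ℕ × Fin n) 0ℓ
  _<ᵉ_ = ×-Lex _≡_ ℚ._<_ (×-Lex _≡_ (flip ℕ._<_) Fin._<_)

  _<ᵇ_ : Rel (ℤ × ℚ × ℕ × Fin n) 0ℓ
  _<ᵇ_ = ×-Lex _≡_ ℤ._<_ _<ᵉ_

  endpointKey : ℕ → Fin n → ℚ × ℕ × Fin n
  endpointKey ρ x = endpoint ρ x , ρ , x

  blockKeyAt : ℤ → Fin n → ℤ × ℚ × ℕ × Fin n
  blockKeyAt m x = m /ℕ 3 , endpointKey (m %ℕ 3) x

  blockKey : Fin 3 → Fin n → ℤ × ℚ × ℕ × Fin n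
  blockKey s x = blockKeyAt (cell x ℤ.+ + toℕ s) x

  blockKey-< : ∀ s {x y} → r x ℚ.< l y → blockKey s x <ᵇ blockKey s y
  blockKey-< s rx<ly with <⇒quotRem-<ₗₑₓ 3 (ℤ.+-monoˡ-< (+ toℕ s) (cell-< rx<ly))
  ... | inj₁ b<b′          = inj₁ b<b′
  ... | inj₂ (b≡b′ , ρ<ρ′) = inj₂ (b≡b′ , inj₁ (endpoint-< ρ<ρ′ rx<ly))

  blockExtension : Fin 3 → LinearExtension P
  blockExtension s = keyedExtension P
    (×-isStrictTotalOrder ℤ.<-isStrictTotalOrder
      (×-isStrictTotalOrder ℚ.<-isStrictTotalOrder
        (×-isStrictTotalOrder (Flip.isStrictTotalOrder ℕ.<-isStrictTotalOrder) Fin.<-isStrictTotalOrder)))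
    (blockKey s) (proj₂ ∘ proj₂ ∘ proj₂) (λ _ _ x<y → blockKey-< s (<P⇒r<l x<y))

  extensions : Fin 4 → LinearExtension P
  extensions zero    = cellExtension
  extensions (suc s) = blockExtension s

  Reversed : Fin n → Fin n → Set
  Reversed x y = ∃[ i ] ¬ _<L_ (extensions i) x y

  reversedBy : ∀ i {x y} → _<L_ (extensions i) y x → Reversed x y
  reversedBy i y<x = i , IsStrictTotalOrder.asym (isSTO (extensions i)) y<x

  overlap⇒endpointKey-< : ∀ {ρ ρ′ x y} → ρ ≡ 0 → 0 ℕ.< ρ′ → l y ℚ.≤ r x →
                          endpointKey ρ′ y <ᵉ endpointKey ρ x
  overlap⇒endpointKey-< {x = x} {y} refl (ℕ.s≤s _) ly≤rx with ℚ.<-cmp (l y) (r x)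
  ... | tri< ly<rx _ _ = inj₁ ly<rx
  ... | tri≈ _ ly≡rx _ = inj₂ (ly≡rx , inj₁ ℕ.z<s)
  ... | tri> _ _ rx<ly = contradiction (ℚ.≤-<-trans ly≤rx rx<ly) (ℚ.<-irrefl refl)

  crossingReversal : ∀ {x y} → cell x ℤ.< cell y → l y ℚ.≤ r x → Reversed x y
  crossingReversal {x} {y} cx<cy ly≤rx with remainder-shift 3 (cell x) {0} ℕ.z<s
  ... | s , ρx≡0
    with sameBlock 2 ρx≡0 (ℤ.+-monoˡ-< (+ toℕ s) cx<cy)
                          (i≤a+j⇒i+k≤a+[j+k] {j = cell x} (+ 2) (+ toℕ s) (cell-≤ ly≤rx))
  ... | by≡bx , 0<ρy = reversedBy (suc s) (inj₂ (by≡bx , overlap⇒endpointKey-< ρx≡0 0<ρy ly≤rx))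

  sameCell-blockKey : ∀ s {ρ x y} → (cell x ℤ.+ + toℕ s) %ℕ 3 ≡ ρ → cell y ≡ cell x →
                      endpointKey ρ y <ᵉ endpointKey ρ x → blockKey s y <ᵇ blockKey s x
  sameCell-blockKey s {x = x} {y} refl cy≡cx ey<ex =
    subst (λ c → blockKeyAt (c ℤ.+ + toℕ s) y <ᵇ blockKey s x) (sym cy≡cx) (inj₂ (refl , ey<ex))

  reversedAtPosition : ∀ (ρ : Fin 3) {x y} → cell y ≡ cell x →
                       endpointKey (toℕ ρ) y <ᵉ endpointKey (toℕ ρ) x → Reversed x y
  reversedAtPosition ρ {x} cy≡cx ey<ex with remainder-shift 3 (cell x) (Fin.toℕ<n ρ)
  ... | s , ρx≡ρ = reversedBy (suc s) (sameCell-blockKey s ρx≡ρ cy≡cx ey<ex)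

  sameCellReversal : ∀ {x y} → cell x ≡ cell y → Reversed x y
  sameCellReversal {x} {y} cx≡cy with ℚ.<-cmp (l x) (l y)
  ... | tri< lx<ly _ _ = reversedBy zero (inj₂ (sym cx≡cy , inj₁ lx<ly))
  ... | tri> _ _ ly<lx = reversedAtPosition (suc zero) (sym cx≡cy) (inj₁ ly<lx)
  ... | tri≈ _ lx≡ly _ with ℚ.<-cmp (r x) (r y)
  ...   | tri< rx<ry _ _ = reversedBy zero (inj₂ (sym cx≡cy , inj₂ (sym lx≡ly , inj₁ rx<ry)))
  ...   | tri> _ _ ry<rx = reversedAtPosition zero (sym cx≡cy) (inj₁ ry<rx)
  ...   | tri≈ _ rx≡ry _ with Fin.<-cmp x y
  ...     | tri< x<y _ _ = reversedBy zero (inj₂ (sym cx≡cy , inj₂ (sym lx≡ly , inj₂ (sym rx≡ry , x<y))))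
  ...     | tri≈ _ refl _ = zero , IsStrictTotalOrder.irrefl (isSTO cellExtension) refl
  ...     | tri> _ _ y<x = reversedAtPosition zero (sym cx≡cy) (inj₂ (sym rx≡ry , inj₂ (refl , y<x)))

  overlap⇒Reversed : ∀ {x y} → l y ℚ.≤ r x → Reversed x y
  overlap⇒Reversed {x} {y} ly≤rx with ℤ.<-cmp (cell x) (cell y)
  ... | tri< cx<cy _ _ = crossingReversal cx<cy ly≤rx
  ... | tri≈ _ cx≡cy _ = sameCellReversal cx≡cy
  ... | tri> _ _ cy<cx = reversedBy zero (inj₁ cy<cx)

  realizer : Realizer P 4
  realizer = realizer-fromReversals P extensions separated
    where
    separated : ∀ x y → _<P_ P x y ⊎ Reversed x y
    separated x y with r x ℚ.<? l y
    ... | yes rx<ly = inj₁ (r<l⇒<P rx<ly)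
    ... | no rx≮ly  = inj₂ (overlap⇒Reversed (ℚ.≮⇒≥ rx≮ly))

theorem7p2 : (n : ℕ) (P : FinPoset n) → InC 2ℚ P → DimLe P 4
theorem7p2 n P I = 4 , ℕ.≤-refl , realizer P I
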